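{- Let $n \geq 8$ and let $G = CS_{7,n-7}$ be the cycle-star graph with cycle length $k=7$ and $n-k \geq 1$ pendant vertices. Then $es(G) = n-3$ if $n = 8$; $es(G) = n-4$ if $n \in \{9,10\}$; and $es(G) = n-5$ if $n \geq 11$.
   Context: For integers $k \geq 3$ and $n > k$, the cycle-star graph $CS_{k,n-k}$ is the simple graph on $n$ vertices consisting of a cycle of length $k$ together with $n-k$ additional vertices of degree one (leaves), all adjacent to the same single vertex of the cycle. For a simple graph $G$, a vertex $k$-labeling is a map $\phi: V(G) \to \{1,2,\ldots,k\}$; the weight of an edge $uv$ is $w_\phi(uv) = \phi(u)+\phi(v)$. The labeling is an edge irregular $k$-labeling if distinct edges have distinct weights. The edge irregularity strength $es(G)$ is the minimum $k$ for which $G$ admits an edge irregular $k$-labeling. -}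

module Defs where

open import Data.Nat using (ℕ; zero; suc; _+_; _∸_; _≤_; _<_)
open import Data.List using (List; []; _∷_; _++_; map; length; upTo)
open import Data.Fin using (Fin)
open import Data.Product using (_×_; _,_; proj₁; proj₂; Σ; ∃)
open import Relation.Binary.PropositionalEquality using (_≡_)
open import Data.List using (lookup)

-- A simple graph given by its vertex count and an explicit list of edges,
-- each edge an unordered pair {u,v} represented by (u , v) with u , v < n.
-- Distinct edges are distinct positions of the edge list.
record Graph : Set where
  field
    nV    : ℕ
    edges : List (ℕ × ℕ)
open Graph public

-- Cycle-star graph CS_{k,n-k}: vertices 0 .. n-1.
-- Cycle 0 - 1 - ... - (k-1) - 0 (edges {k-1,0} and {i, i+1} for i < k-1),
-- leaves k .. n-1 each adjacent to vertex 0.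
CS : (k n : ℕ) → Graph
CS k n = record
  { nV = n
  ; edges = (k ∸ 1 , 0) ∷ map (λ i → (i , suc i)) (upTo (k ∸ 1))
         ++ map (λ j → (0 , k + j)) (upTo (n ∸ k)) }

IsLabeling : (G : Graph) (k : ℕ) (φ : ℕ → ℕ) → Set
IsLabeling G k φ = ∀ v → v < nV G → 1 ≤ φ v × φ v ≤ k

weight : (φ : ℕ → ℕ) → ℕ × ℕ → ℕ
weight φ (u , v) = φ u + φ v

EdgeIrregular : (G : Graph) (φ : ℕ → ℕ) → Set
EdgeIrregular G φ = ∀ (i j : Fin (length (edges G))) →
  weight φ (lookup (edges G) i) ≡ weight φ (lookup (edges G) j) → i ≡ j

HasEIL : Graph → ℕ → Set
HasEIL G k = Σ (ℕ → ℕ) λ φ → IsLabeling G k φ × EdgeIrregular G φ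

es≡ : Graph → ℕ → Set
es≡ G m = HasEIL G m × (∀ k → k < m → HasEIL G k → Data.Empty.⊥)
  where import Data.Empty

module Submission where

-- Every edge weight lies in {2, …, 2k}, so an edge irregular k-labeling of a graph with e edges
-- needs e ≤ 2k − 1; for n = 8, 9, 10 this gives k ≥ 5, 5, 6, attained by labelings checked by
-- computation. For n ≥ 11 the hub 0 has n − 5 neighbours, which need pairwise distinct labels since
-- their edges share the hub, so k ≥ n − 5. Conversely, labelling the hub n − 5, the cycle vertices
-- 1, …, 6 by 1, 1, 2, 2, 3, 3 and the leaves 7, 8, 9, … by 2, 4, 5, … gives the hub's neighbours each
-- label 1, …, n − 5 exactly once, so the hub edges get the weights n − 4, …, 2n − 10 and the path
-- 1 – … – 6 gets 2, …, 6.

open import Defs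
open import Data.Nat using (ℕ; suc; _+_; _∸_; _≤_; _<_; z≤n; s≤s; _≤?_; _≟_)
open import Data.Nat.Properties
  using (≤-refl; ≤-trans; ≤-<-trans; <-trans; <⇒≤; <⇒≱; ≰⇒>; +-mono-≤; +-monoʳ-<; ∸-monoˡ-≤;
         ∸-monoˡ-<; ∸-cancelʳ-≡; m∸n≤m; m+[n∸m]≡n; m≤m+n; m+n∸m≡n; m+n∸n≡m; 0∸n≡0; +-comm;
         m≤n⇒∃[o]m+o≡n)
open import Data.Fin using (Fin; toℕ; fromℕ<) renaming (_≟_ to _≟ᶠ_)
open import Data.Fin.Properties using (injective⇒≤; toℕ-injective; toℕ-fromℕ<; fromℕ<-injective; toℕ<n; all?)
open import Data.List using (List; _∷_; lookup; length; applyUpTo)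
open import Data.List.Properties using (lookup-applyUpTo; length-applyUpTo; map-applyUpTo)
open import Data.List.Relation.Unary.All as All using (All; _∷_)
open import Data.List.Relation.Unary.All.Properties using (++⁺; map⁺; applyUpTo⁺₁)
open import Data.List.Membership.Propositional.Properties using (∈-lookup)
open import Data.Product using (_×_; _,_; proj₁; proj₂)
open import Data.Sum using (_⊎_; inj₁; inj₂)
open import Function.Definitions using (Injective)
open import Relation.Binary.PropositionalEquality using (_≡_; refl; sym; trans; cong; subst; module ≡-Reasoning)
open import Relation.Nullary using (¬_)
open import Relation.Nullary.Decidable using (Dec; map′; from-yes; _×-dec_; _→-dec_)

interval-injective⇒≤ : ∀ {d a b} (f : Fin d → ℕ) → Injective _≡_ _≡_ f →
                       (∀ i → a ≤ f i × f i ≤ b) → d ≤ suc b ∸ a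
interval-injective⇒≤ {d} {a} {b} f f-inj bounds = injective⇒≤ {f = shift} shift-inj
  where
  shift< : ∀ i → f i ∸ a < suc b ∸ a
  shift< i = ∸-monoˡ-< (s≤s (proj₂ (bounds i))) (proj₁ (bounds i))

  shift : Fin d → Fin (suc b ∸ a)
  shift i = fromℕ< (shift< i)

  shift-inj : Injective _≡_ _≡_ shift
  shift-inj {i} {j} eq =
    f-inj (∸-cancelʳ-≡ (proj₁ (bounds i)) (proj₁ (bounds j)) (fromℕ<-injective _ _ (shift< i) (shift< j) eq))

InRange : ℕ → ℕ × ℕ → Set
InRange n (u , v) = u < n × v < n

edges≤ : ∀ {G k} → All (InRange (nV G)) (edges G) → HasEIL G k → length (edges G) ≤ k + k ∸ 1
edges≤ {G} {k} inRange (φ , labeling , irregular) =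
  interval-injective⇒≤ (λ i → weight φ (lookup (edges G) i)) (irregular _ _) bounds
  where
  bounds : ∀ i → 2 ≤ weight φ (lookup (edges G) i) × weight φ (lookup (edges G) i) ≤ k + k
  bounds i with lookup (edges G) i | All.lookup inRange (∈-lookup i)
  ... | u , v | u< , v< with labeling u u< | labeling v v<
  ... | 1≤φu , φu≤k | 1≤φv , φv≤k = +-mono-≤ 1≤φu 1≤φv , +-mono-≤ φu≤k φv≤k

size-lower-bound : ∀ {G m k} → All (InRange (nV G)) (edges G) →
                   m + m ∸ 1 < length (edges G) → HasEIL G k → m < k
size-lower-bound {m = m} {k} inRange many eil = ≰⇒> k≰m
  where
  k≰m : ¬ (k ≤ m)
  k≰m k≤m = <⇒≱ many (≤-trans (edges≤ inRange eil) (∸-monoˡ-≤ 1 (+-mono-≤ k≤m k≤m)))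

CS-inRange : ∀ {k n} → k < n → All (InRange n) (edges (CS k n))
CS-inRange {k} {n} k<n =
  (k∸1<n , ≤-<-trans z≤n k<n) ∷ ++⁺ (map⁺ (applyUpTo⁺₁ _ (k ∸ 1) path)) (map⁺ (applyUpTo⁺₁ _ (n ∸ k) leaf))
  where
  k∸1<n : k ∸ 1 < n
  k∸1<n = ≤-<-trans (m∸n≤m k 1) k<n

  path : ∀ {i} → i < k ∸ 1 → InRange n (i , suc i)
  path i< = <-trans i< k∸1<n , ≤-<-trans i< k∸1<n

  leaf : ∀ {j} → j < n ∸ k → InRange n (0 , k + j)
  leaf {j} j< = ≤-<-trans z≤n k<n , subst (k + j <_) (m+[n∸m]≡n (<⇒≤ k<n)) (+-monoʳ-< k j<)

DistinctWeights : (ℕ → ℕ) → List (ℕ × ℕ) → Set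
DistinctWeights φ es = ∀ (i j : Fin (length es)) → weight φ (lookup es i) ≡ weight φ (lookup es j) → i ≡ j

module _ (φ : ℕ → ℕ) (E : ℕ → ℕ × ℕ) (n : ℕ) where
  open ≡-Reasoning

  distinctWeights-applyUpTo⁺ : (∀ {t s} → t < n → s < n → weight φ (E t) ≡ weight φ (E s) → t ≡ s) →
                               DistinctWeights φ (applyUpTo E n)
  distinctWeights-applyUpTo⁺ inj i j eq = toℕ-injective (inj (bound i) (bound j) (begin
    weight φ (E (toℕ i))                ≡⟨ cong (weight φ) (lookup-applyUpTo E n i) ⟨
    weight φ (lookup (applyUpTo E n) i) ≡⟨ eq ⟩
    weight φ (lookup (applyUpTo E n) j) ≡⟨ cong (weight φ) (lookup-applyUpTo E n j) ⟩
    weight φ (E (toℕ j))                ∎))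
    where
    bound : (i : Fin (length (applyUpTo E n))) → toℕ i < n
    bound i = subst (toℕ i <_) (length-applyUpTo E n) (toℕ<n i)

  distinctWeights-applyUpTo⁻ : DistinctWeights φ (applyUpTo E n) →
                               ∀ {t s} → t < n → s < n → weight φ (E t) ≡ weight φ (E s) → t ≡ s
  distinctWeights-applyUpTo⁻ distinct {t} {s} t<n s<n eq =
    fromℕ<-injective t s (index< t<n) (index< s<n) (distinct _ _ (begin
      weight φ (lookup (applyUpTo E n) (fromℕ< (index< t<n))) ≡⟨ cong (weight φ) (lookup-index t<n) ⟩
      weight φ (E t)                                         ≡⟨ eq ⟩
      weight φ (E s)                                         ≡⟨ cong (weight φ) (lookup-index s<n) ⟨
      weight φ (lookup (applyUpTo E n) (fromℕ< (index< s<n))) ∎))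
    where
    index< : ∀ {t} → t < n → t < length (applyUpTo E n)
    index< {t} = subst (t <_) (sym (length-applyUpTo E n))

    lookup-index : ∀ {t} (t<n : t < n) → lookup (applyUpTo E n) (fromℕ< (index< t<n)) ≡ E t
    lookup-index t<n = trans (lookup-applyUpTo E n _) (cong E (toℕ-fromℕ< (index< t<n)))

isLabeling? : ∀ G k φ → Dec (IsLabeling G k φ)
isLabeling? G k φ = map′ fromFin toFin (all? λ v → (1 ≤? φ (toℕ v)) ×-dec (φ (toℕ v) ≤? k))
  where
  fromFin : (∀ (v : Fin (nV G)) → 1 ≤ φ (toℕ v) × φ (toℕ v) ≤ k) → IsLabeling G k φ
  fromFin h v v< = subst (λ u → 1 ≤ φ u × φ u ≤ k) (toℕ-fromℕ< v<) (h (fromℕ< v<))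

  toFin : IsLabeling G k φ → ∀ (v : Fin (nV G)) → 1 ≤ φ (toℕ v) × φ (toℕ v) ≤ k
  toFin h v = h (toℕ v) (toℕ<n v)

edgeIrregular? : ∀ G φ → Dec (EdgeIrregular G φ)
edgeIrregular? G φ = all? λ i → all? λ j →
  (weight φ (lookup (edges G) i) ≟ weight φ (lookup (edges G) j)) →-dec (i ≟ᶠ j)

es≡-intro : ∀ {G m} → HasEIL G m → (∀ {k} → HasEIL G k → m ≤ k) → es≡ G m
es≡-intro eil lower = eil , λ k k<m eilₖ → <⇒≱ k<m (lower eilₖ)

labels-CS-7-8 : ℕ → ℕ
labels-CS-7-8 0 = 1
labels-CS-7-8 1 = 1
labels-CS-7-8 2 = 2
labels-CS-7-8 3 = 2
labels-CS-7-8 4 = 5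
labels-CS-7-8 5 = 4
labels-CS-7-8 6 = 4
labels-CS-7-8 _ = 5

es-CS-7-8 : es≡ (CS 7 8) 5
es-CS-7-8 = es≡-intro
  (labels-CS-7-8 , from-yes (isLabeling? (CS 7 8) 5 labels-CS-7-8) , from-yes (edgeIrregular? (CS 7 8) labels-CS-7-8))
  (size-lower-bound {m = 4} (CS-inRange ≤-refl) ≤-refl)

labels-CS-7-9 : ℕ → ℕ
labels-CS-7-9 0 = 1
labels-CS-7-9 1 = 1
labels-CS-7-9 2 = 2
labels-CS-7-9 3 = 5
labels-CS-7-9 4 = 5
labels-CS-7-9 5 = 4
labels-CS-7-9 6 = 4
labels-CS-7-9 7 = 3
labels-CS-7-9 _ = 5

es-CS-7-9 : es≡ (CS 7 9) 5
es-CS-7-9 = es≡-intro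
  (labels-CS-7-9 , from-yes (isLabeling? (CS 7 9) 5 labels-CS-7-9) , from-yes (edgeIrregular? (CS 7 9) labels-CS-7-9))
  (size-lower-bound {m = 4} (CS-inRange (m≤m+n 8 1)) (m≤m+n 8 1))

labels-CS-7-10 : ℕ → ℕ
labels-CS-7-10 0 = 1
labels-CS-7-10 1 = 1
labels-CS-7-10 2 = 2
labels-CS-7-10 3 = 6
labels-CS-7-10 4 = 4
labels-CS-7-10 5 = 5
labels-CS-7-10 6 = 6
labels-CS-7-10 7 = 3
labels-CS-7-10 8 = 4
labels-CS-7-10 _ = 5

es-CS-7-10 : es≡ (CS 7 10) 6
es-CS-7-10 = es≡-intro
  (labels-CS-7-10 , from-yes (isLabeling? (CS 7 10) 6 labels-CS-7-10) , from-yes (edgeIrregular? (CS 7 10) labels-CS-7-10))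
  (size-lower-bound {m = 5} (CS-inRange (m≤m+n 8 2)) ≤-refl)

module CS-7-11+ (m : ℕ) where
  open ≡-Reasoning

  edge : ℕ → ℕ × ℕ
  edge 0 = 6 , 0
  edge (suc (suc (suc (suc (suc (suc (suc j))))))) = 0 , 7 + j
  edge (suc i) = i , suc i

  edges-CS : edges (CS 7 (11 + m)) ≡ applyUpTo edge (11 + m)
  edges-CS = cong (λ leaves → edge 0 ∷ edge 1 ∷ edge 2 ∷ edge 3 ∷ edge 4 ∷ edge 5 ∷ edge 6 ∷
                              edge 7 ∷ edge 8 ∷ edge 9 ∷ edge 10 ∷ leaves)
                  (map-applyUpTo (4 +_) (λ j → 0 , 7 + j) m)

  labels : ℕ → ℕ
  labels 0 = 6 + m
  labels 1 = 1
  labels 2 = 1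
  labels 3 = 2
  labels 4 = 2
  labels 5 = 3
  labels 6 = 3
  labels 7 = 2
  labels (suc (suc (suc (suc (suc (suc (suc (suc j)))))))) = 4 + j

  ≤3⇒≤6+m : ∀ {c} → c ≤ 3 → c ≤ 6 + m
  ≤3⇒≤6+m c≤3 = ≤-trans c≤3 (m≤m+n 3 (3 + m))

  labels-labeling : IsLabeling (CS 7 (11 + m)) (6 + m) labels
  labels-labeling 0 _ = s≤s z≤n , ≤-refl
  labels-labeling 1 _ = s≤s z≤n , ≤3⇒≤6+m (s≤s z≤n)
  labels-labeling 2 _ = s≤s z≤n , ≤3⇒≤6+m (s≤s z≤n)
  labels-labeling 3 _ = s≤s z≤n , ≤3⇒≤6+m (s≤s (s≤s z≤n))
  labels-labeling 4 _ = s≤s z≤n , ≤3⇒≤6+m (s≤s (s≤s z≤n))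
  labels-labeling 5 _ = s≤s z≤n , ≤3⇒≤6+m ≤-refl
  labels-labeling 6 _ = s≤s z≤n , ≤3⇒≤6+m ≤-refl
  labels-labeling 7 _ = s≤s z≤n , ≤3⇒≤6+m (s≤s (s≤s z≤n))
  labels-labeling (suc (suc (suc (suc (suc (suc (suc (suc j))))))))
                  (s≤s (s≤s (s≤s (s≤s (s≤s (s≤s (s≤s (s≤s j<3+m)))))))) = s≤s z≤n , s≤s (s≤s (s≤s j<3+m))

  -- hubNeighbour c is the neighbour of the hub 0 labelled 1 + c, and hubEdge c the index of their edge.
  hubEdge : ℕ → ℕ
  hubEdge 0 = 1
  hubEdge 1 = 7
  hubEdge 2 = 0
  hubEdge (suc (suc (suc j))) = 8 + j

  hubNeighbour : ℕ → ℕ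
  hubNeighbour 0 = 1
  hubNeighbour 1 = 7
  hubNeighbour 2 = 6
  hubNeighbour (suc (suc (suc j))) = 8 + j

  -- The hub edge to the neighbour labelled 1 + c has weight 6 + m + (1 + c); the only other weight
  -- above 5 is the weight 6 of the path edge 5–6, whose offset truncates to 0.
  edgeOfOffset : ℕ → ℕ
  edgeOfOffset 0       = 6
  edgeOfOffset (suc c) = hubEdge c

  edgeOfWeight : ℕ → ℕ
  edgeOfWeight (suc (suc (suc (suc (suc (suc r)))))) = edgeOfOffset (r ∸ m)
  edgeOfWeight w = w

  edgeOfWeight-weight : ∀ t → edgeOfWeight (weight labels (edge t)) ≡ t
  edgeOfWeight-weight 0 = cong edgeOfOffset (m+n∸n≡m 3 m)
  edgeOfWeight-weight 1 = cong edgeOfOffset (m+n∸m≡n m 1)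
  edgeOfWeight-weight 2 = refl
  edgeOfWeight-weight 3 = refl
  edgeOfWeight-weight 4 = refl
  edgeOfWeight-weight 5 = refl
  edgeOfWeight-weight 6 = cong edgeOfOffset (0∸n≡0 m)
  edgeOfWeight-weight 7 = cong edgeOfOffset (m+n∸m≡n m 2)
  edgeOfWeight-weight (suc (suc (suc (suc (suc (suc (suc (suc j)))))))) = cong edgeOfOffset (m+n∸m≡n m (4 + j))

  labels-irregular : EdgeIrregular (CS 7 (11 + m)) labels
  labels-irregular = subst (DistinctWeights labels) (sym edges-CS)
    (distinctWeights-applyUpTo⁺ labels edge (11 + m) λ {t} {s} _ _ eq → begin
      t                                   ≡⟨ edgeOfWeight-weight t ⟨
      edgeOfWeight (weight labels (edge t)) ≡⟨ cong edgeOfWeight eq ⟩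
      edgeOfWeight (weight labels (edge s)) ≡⟨ edgeOfWeight-weight s ⟩
      s                                   ∎)

  hubEdge-weight : ∀ ψ c → weight ψ (edge (hubEdge c)) ≡ ψ 0 + ψ (hubNeighbour c)
  hubEdge-weight ψ 0 = refl
  hubEdge-weight ψ 1 = refl
  hubEdge-weight ψ 2 = +-comm (ψ 6) (ψ 0)
  hubEdge-weight ψ (suc (suc (suc j))) = refl

  hubEdge< : ∀ {c} → c < 6 + m → hubEdge c < 11 + m
  hubEdge< {0} _ = m≤m+n 2 (9 + m)
  hubEdge< {1} _ = m≤m+n 8 (3 + m)
  hubEdge< {2} _ = m≤m+n 1 (10 + m)
  hubEdge< {suc (suc (suc j))} (s≤s (s≤s (s≤s j<3+m))) = s≤s (s≤s (s≤s (s≤s (s≤s (s≤s (s≤s (s≤s j<3+m)))))))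

  hubNeighbour< : ∀ {c} → c < 6 + m → hubNeighbour c < 11 + m
  hubNeighbour< {0} _ = m≤m+n 2 (9 + m)
  hubNeighbour< {1} _ = m≤m+n 8 (3 + m)
  hubNeighbour< {2} _ = m≤m+n 7 (4 + m)
  hubNeighbour< {suc (suc (suc j))} c< = hubEdge< c<

  hubEdge⁻¹ : ℕ → ℕ
  hubEdge⁻¹ 0 = 2
  hubEdge⁻¹ 7 = 1
  hubEdge⁻¹ (suc (suc (suc (suc (suc (suc (suc (suc j)))))))) = 3 + j
  hubEdge⁻¹ _ = 0

  hubEdge⁻¹-hubEdge : ∀ c → hubEdge⁻¹ (hubEdge c) ≡ c
  hubEdge⁻¹-hubEdge 0 = refl
  hubEdge⁻¹-hubEdge 1 = refl
  hubEdge⁻¹-hubEdge 2 = refl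
  hubEdge⁻¹-hubEdge (suc (suc (suc j))) = refl

  hub-lower-bound : ∀ {k} → HasEIL (CS 7 (11 + m)) k → 6 + m ≤ k
  hub-lower-bound (ψ , labeling , irregular) =
    interval-injective⇒≤ neighbourLabel neighbourLabel-injective
      (λ c → labeling _ (hubNeighbour< (toℕ<n c)))
    where
    neighbourLabel : Fin (6 + m) → ℕ
    neighbourLabel c = ψ (hubNeighbour (toℕ c))

    distinct : ∀ {t s} → t < 11 + m → s < 11 + m → weight ψ (edge t) ≡ weight ψ (edge s) → t ≡ s
    distinct = distinctWeights-applyUpTo⁻ ψ edge (11 + m) (subst (DistinctWeights ψ) edges-CS irregular)

    neighbourLabel-injective : Injective _≡_ _≡_ neighbourLabel
    neighbourLabel-injective {c} {c′} eq = toℕ-injective (begin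
      toℕ c                        ≡⟨ hubEdge⁻¹-hubEdge (toℕ c) ⟨
      hubEdge⁻¹ (hubEdge (toℕ c))  ≡⟨ cong hubEdge⁻¹ same-edge ⟩
      hubEdge⁻¹ (hubEdge (toℕ c′)) ≡⟨ hubEdge⁻¹-hubEdge (toℕ c′) ⟩
      toℕ c′                       ∎)
      where
      same-edge : hubEdge (toℕ c) ≡ hubEdge (toℕ c′)
      same-edge = distinct (hubEdge< (toℕ<n c)) (hubEdge< (toℕ<n c′)) (begin
        weight ψ (edge (hubEdge (toℕ c)))  ≡⟨ hubEdge-weight ψ (toℕ c) ⟩
        ψ 0 + neighbourLabel c             ≡⟨ cong (ψ 0 +_) eq ⟩
        ψ 0 + neighbourLabel c′            ≡⟨ hubEdge-weight ψ (toℕ c′) ⟨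
        weight ψ (edge (hubEdge (toℕ c′))) ∎)

  es≡6+m : es≡ (CS 7 (11 + m)) (6 + m)
  es≡6+m = es≡-intro (labels , labels-labeling , labels-irregular) hub-lower-bound

es-CS-7-≥11 : ∀ {n} → 11 ≤ n → es≡ (CS 7 n) (n ∸ 5)
es-CS-7-≥11 11≤n with m , refl ← m≤n⇒∃[o]m+o≡n 11≤n = CS-7-11+.es≡6+m m

theorem3p6 : ∀ (n : ℕ) → 8 ≤ n →
    (n ≡ 8 → es≡ (CS 7 n) (n ∸ 3)) ×
    ((n ≡ 9 ⊎ n ≡ 10) → es≡ (CS 7 n) (n ∸ 4)) ×
    (11 ≤ n → es≡ (CS 7 n) (n ∸ 5))
theorem3p6 n _ =
  (λ { refl → es-CS-7-8 }) ,
  (λ { (inj₁ refl) → es-CS-7-9 ; (inj₂ refl) → es-CS-7-10 }) ,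
  es-CS-7-≥11
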